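{- Let $\mathscr{A}$ be a non-empty closed set of impartial games. Then either (i) every $G\in\mathscr{A}$ satisfies $G=^-0$ or $G=^-\ast$; or (ii) there exists $G\in\mathscr{A}$ with $G=^-\ast 2$.
   Context: All games are impartial; $\ast$ and $\ast 2$ are Nim-heaps of sizes 1 and 2. $o^-(G)$ is the misère outcome (last player to move loses). $G=^-H$ means $o^-(G+X)=o^-(H+X)$ for every impartial game $X$. A set of games is closed if it is closed under disjunctive sum and every option of a member is a member. -}

module Defs where

open import Data.Nat using (ℕ; zero; suc; _+_)
open import Data.Fin using (Fin; zero; suc; splitAt)
open import Data.Bool using (Bool; true; false; not; _∨_)
open import Data.Sum using (_⊎_; inj₁; inj₂; [_,_])
open import Relation.Binary.PropositionalEquality using (_≡_)

-- Short impartial games (game forms): a game is given by its finitely many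
-- options; well-foundedness is built into the inductive type.
data Game : Set where
  mk : (n : ℕ) → (Fin n → Game) → Game

𝟘 : Game
𝟘 = mk 0 (λ ())

∗ : Game
∗ = mk 1 (λ _ → 𝟘)

∗2 : Game
∗2 = mk 2 λ { zero → 𝟘 ; (suc zero) → ∗ }

infixl 6 _⊕_
_⊕_ : Game → Game → Game
mk n f ⊕ mk m g =
  mk (n + m) (λ i → [ (λ j → f j ⊕ mk m g) , (λ j → mk n f ⊕ g j) ] (splitAt n i))

anyFin : (n : ℕ) → (Fin n → Bool) → Bool
anyFin zero    p = false
anyFin (suc n) p = p zero ∨ anyFin n (λ i → p (suc i))

-- misère outcome: nextWins⁻ G = true iff o⁻(G) = N (the player to move wins
-- when the last player to move loses).
nextWins⁻ : Game → Bool
nextWins⁻ (mk zero    f) = true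
nextWins⁻ (mk (suc n) f) = anyFin (suc n) (λ i → not (nextWins⁻ (f i)))

data Outcome : Set where
  N P : Outcome

o⁻ : Game → Outcome
o⁻ G with nextWins⁻ G
... | true  = N
... | false = P

infix 4 _=⁻_
_=⁻_ : Game → Game → Set
G =⁻ H = ∀ (X : Game) → o⁻ (G ⊕ X) ≡ o⁻ (H ⊕ X)

record Closed (𝒜 : Game → Set) : Set where
  field
    sum-closed    : ∀ {G H} → 𝒜 G → 𝒜 H → 𝒜 (G ⊕ H)
    option-closed : ∀ {n f} → 𝒜 (mk n f) → (i : Fin n) → 𝒜 (f i)

{-# OPTIONS --safe #-}
-- If 𝒜 contains no game equivalent to ∗2, induction on games shows that every G ∈ 𝒜
-- is equivalent to 0 or ∗.  The options of G lie in 𝒜, hence are each equivalent to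
-- 0 or ∗, and replacing options by equivalent games preserves misère equivalence.  So
-- G is equivalent to {} = 0, {0} = ∗, {0, ∗} = ∗2 (excluded) or {∗}; and {∗} =⁻ 0,
-- because the move from {∗} + X to ∗ + X is reversed by the reply 0 + X.  Excluded
-- middle only decides whether 𝒜 meets the class of ∗2: as 0 and ∗ are distinguishable,
-- the classification of the options can be searched constructively.
module Submission where

open import Defs
open import Level using (0ℓ)
open import Axiom.ExcludedMiddle using (ExcludedMiddle)
open import Data.Product using (Σ; _×_; _,_; ∃-syntax)
open import Data.Sum using (_⊎_; inj₁; inj₂; [_,_])
import Data.Sum as Sum
open import Data.Nat using (ℕ; zero; suc; _+_; _≡ᵇ_)
open import Data.Fin using (Fin; zero; suc; splitAt)
open import Data.Fin.Properties using (any?)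
open import Data.Bool using (Bool; true; false; not; _∨_; _∧_; if_then_else_)
open import Data.Sum.Properties using ([,]-map)
open import Data.Bool.Properties using (∨-assoc; ∨-zeroʳ)
open import Data.Empty using (⊥-elim)
open import Relation.Nullary using (¬_; Dec; yes; no)
open import Relation.Binary.PropositionalEquality
  using (_≡_; refl; sym; trans; cong; cong₂; module ≡-Reasoning)

anyFin-sound : ∀ n (p : Fin n → Bool) → anyFin n p ≡ true → ∃[ i ] p i ≡ true
anyFin-sound (suc n) p any-p with p zero in p0
... | true  = zero , p0
... | false with anyFin-sound n (λ i → p (suc i)) any-p
...   | i , pi = suc i , pi

anyFin-complete : ∀ n (p : Fin n → Bool) i → p i ≡ true → anyFin n p ≡ true
anyFin-complete (suc n) p zero    pi rewrite pi = refl
anyFin-complete (suc n) p (suc i) pi with p zero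
... | true  = refl
... | false = anyFin-complete n (λ i → p (suc i)) i pi

anyFin-mono : ∀ {n m} {p : Fin n → Bool} {q : Fin m → Bool} →
  (∀ i → ∃[ j ] p i ≡ q j) → anyFin n p ≡ true → anyFin m q ≡ true
anyFin-mono {n} {m} {p} {q} p⊆q any-p with anyFin-sound n p any-p
... | i , pi with p⊆q i
...   | j , pi≡qj = anyFin-complete m q j (trans (sym pi≡qj) pi)

anyFin-covered : ∀ {n m} {p : Fin n → Bool} {q : Fin m → Bool} →
  (∀ i → ∃[ j ] p i ≡ q j) → (∀ j → ∃[ i ] q j ≡ p i) → anyFin n p ≡ anyFin m q
anyFin-covered {n} {m} {p} {q} p⊆q q⊆p with anyFin n p in any-p | anyFin m q in any-q
... | false | false = refl
... | true  | true  = refl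
... | true  | false = trans (sym (anyFin-mono p⊆q any-p)) any-q
... | false | true  = trans (sym any-p) (anyFin-mono q⊆p any-q)

anyFin-cong : ∀ {n} {p q : Fin n → Bool} → (∀ i → p i ≡ q i) → anyFin n p ≡ anyFin n q
anyFin-cong p≗q = anyFin-covered (λ i → i , p≗q i) (λ i → i , sym (p≗q i))

anyFin-splitAt : ∀ {A : Set} n m (r : A → Bool) (a : Fin n → A) (b : Fin m → A) →
  anyFin (n + m) (λ i → r ([ a , b ] (splitAt n i))) ≡ anyFin n (λ i → r (a i)) ∨ anyFin m (λ j → r (b j))
anyFin-splitAt zero    m r a b = refl
anyFin-splitAt (suc n) m r a b = begin
  r (a zero) ∨ anyFin (n + m) (λ i → r ([ a , b ] (splitAt (suc n) (suc i))))
    ≡⟨ cong (r (a zero) ∨_) (anyFin-cong (λ i → cong r ([,]-map (splitAt n i)))) ⟩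
  r (a zero) ∨ anyFin (n + m) (λ i → r ([ (λ i → a (suc i)) , b ] (splitAt n i)))
    ≡⟨ cong (r (a zero) ∨_) (anyFin-splitAt n m r (λ i → a (suc i)) b) ⟩
  r (a zero) ∨ (anyFin n (λ i → r (a (suc i))) ∨ anyFin m (λ j → r (b j)))
    ≡⟨ sym (∨-assoc (r (a zero)) _ _) ⟩
  anyFin (suc n) (λ i → r (a i)) ∨ anyFin m (λ j → r (b j))
    ∎
  where open ≡-Reasoning

nextWins⁻-mk : ∀ n (f : Fin n → Game) →
  nextWins⁻ (mk n f) ≡ (n ≡ᵇ 0) ∨ anyFin n (λ i → not (nextWins⁻ (f i)))
nextWins⁻-mk zero    f = refl
nextWins⁻-mk (suc n) f = refl

nextWins⁻-⊕ : ∀ n (f : Fin n → Game) m (g : Fin m → Game) →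
  nextWins⁻ (mk n f ⊕ mk m g) ≡
    ((n ≡ᵇ 0) ∧ (m ≡ᵇ 0)) ∨
    (anyFin n (λ i → not (nextWins⁻ (f i ⊕ mk m g))) ∨ anyFin m (λ j → not (nextWins⁻ (mk n f ⊕ g j))))
nextWins⁻-⊕ n f m g =
  trans (nextWins⁻-mk (n + m) _)
        (cong₂ _∨_ (+≡ᵇ0 n) (anyFin-splitAt n m (λ G → not (nextWins⁻ G)) _ _))
  where
  +≡ᵇ0 : ∀ n → (n + m ≡ᵇ 0) ≡ (n ≡ᵇ 0) ∧ (m ≡ᵇ 0)
  +≡ᵇ0 zero    = refl
  +≡ᵇ0 (suc n) = refl

-- =⁻ with the outcomes compared as booleans; a record, so that G and H are inferable.
infix 4 _≈_
record _≈_ (G H : Game) : Set where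
  constructor mk≈
  field ≈-nextWins⁻ : ∀ X → nextWins⁻ (G ⊕ X) ≡ nextWins⁻ (H ⊕ X)
open _≈_

≈-sym : ∀ {G H} → G ≈ H → H ≈ G
≈-sym G≈H = mk≈ λ X → sym (≈-nextWins⁻ G≈H X)

≈-trans : ∀ {G H K} → G ≈ H → H ≈ K → G ≈ K
≈-trans G≈H H≈K = mk≈ λ X → trans (≈-nextWins⁻ G≈H X) (≈-nextWins⁻ H≈K X)

o⁻-nextWins⁻ : ∀ G → o⁻ G ≡ (if nextWins⁻ G then N else P)
o⁻-nextWins⁻ G with nextWins⁻ G
... | true  = refl
... | false = refl

≈⇒=⁻ : ∀ {G H} → G ≈ H → G =⁻ H
≈⇒=⁻ {G} {H} G≈H X = begin
  o⁻ (G ⊕ X)                                 ≡⟨ o⁻-nextWins⁻ (G ⊕ X) ⟩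
  (if nextWins⁻ (G ⊕ X) then N else P)       ≡⟨ cong (if_then N else P) (≈-nextWins⁻ G≈H X) ⟩
  (if nextWins⁻ (H ⊕ X) then N else P)       ≡⟨ sym (o⁻-nextWins⁻ (H ⊕ X)) ⟩
  o⁻ (H ⊕ X)                                 ∎
  where open ≡-Reasoning

≈𝟘⇒≉∗ : ∀ {G} → G ≈ 𝟘 → ¬ G ≈ ∗
≈𝟘⇒≉∗ G≈𝟘 G≈∗ with ≈-nextWins⁻ (≈-trans (≈-sym G≈𝟘) G≈∗) 𝟘
... | ()

≈𝟘? : ∀ {G} → G ≈ 𝟘 ⊎ G ≈ ∗ → Dec (G ≈ 𝟘)
≈𝟘? (inj₁ G≈𝟘) = yes G≈𝟘
≈𝟘? (inj₂ G≈∗) = no λ G≈𝟘 → ≈𝟘⇒≉∗ G≈𝟘 G≈∗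

≈∗? : ∀ {G} → G ≈ 𝟘 ⊎ G ≈ ∗ → Dec (G ≈ ∗)
≈∗? (inj₁ G≈𝟘) = no (≈𝟘⇒≉∗ G≈𝟘)
≈∗? (inj₂ G≈∗) = yes G≈∗

arity : Game → ℕ
arity (mk n _) = n

options : (G : Game) → Fin (arity G) → Game
options (mk _ f) = f

infix 4 _≈⊆_
_≈⊆_ : ∀ {n m} → (Fin n → Game) → (Fin m → Game) → Set
f ≈⊆ h = ∀ i → ∃[ j ] f i ≈ h j

options≈⇒≈ : ∀ G H → options G ≈⊆ options H → options H ≈⊆ options G → G ≈ H
options≈⇒≈ G@(mk n f) H@(mk m h) f⊆h h⊆f = mk≈ same-outcome
  where
  open ≡-Reasoning

  both-terminal : ∀ {n m} (f : Fin n → Game) (h : Fin m → Game) →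
    f ≈⊆ h → h ≈⊆ f → (n ≡ᵇ 0) ≡ (m ≡ᵇ 0)
  both-terminal {zero}  {zero}  _ _ _   _   = refl
  both-terminal {zero}  {suc m} _ _ _   h⊆f with h⊆f zero
  ... | () , _
  both-terminal {suc n} {zero}  _ _ f⊆h _   with f⊆h zero
  ... | () , _
  both-terminal {suc n} {suc m} _ _ _   _   = refl

  matched : ∀ {n m} (f : Fin n → Game) (h : Fin m → Game) → f ≈⊆ h → ∀ X i →
    ∃[ j ] not (nextWins⁻ (f i ⊕ X)) ≡ not (nextWins⁻ (h j ⊕ X))
  matched f h f⊆h X i with f⊆h i
  ... | j , fi≈hj = j , cong not (≈-nextWins⁻ fi≈hj X)

  same-outcome : ∀ X → nextWins⁻ (G ⊕ X) ≡ nextWins⁻ (H ⊕ X)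
  same-outcome X@(mk k g) = begin
    nextWins⁻ (G ⊕ X)
      ≡⟨ nextWins⁻-⊕ n f k g ⟩
    ((n ≡ᵇ 0) ∧ (k ≡ᵇ 0)) ∨
      (anyFin n (λ i → not (nextWins⁻ (f i ⊕ X))) ∨ anyFin k (λ j → not (nextWins⁻ (G ⊕ g j))))
      ≡⟨ cong₂ _∨_ (cong (_∧ (k ≡ᵇ 0)) (both-terminal f h f⊆h h⊆f))
                   (cong₂ _∨_ (anyFin-covered (matched f h f⊆h X) (matched h f h⊆f X))
                              (anyFin-cong (λ j → cong not (same-outcome (g j))))) ⟩
    ((m ≡ᵇ 0) ∧ (k ≡ᵇ 0)) ∨
      (anyFin m (λ i → not (nextWins⁻ (h i ⊕ X))) ∨ anyFin k (λ j → not (nextWins⁻ (H ⊕ g j))))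
      ≡⟨ sym (nextWins⁻-⊕ m h k g) ⟩
    nextWins⁻ (H ⊕ X)
      ∎

⁅∗⁆ : Game
⁅∗⁆ = mk 1 (λ _ → ∗)

⁅∗⁆≈𝟘 : ⁅∗⁆ ≈ 𝟘
⁅∗⁆≈𝟘 = mk≈ same-outcome
  where
  open ≡-Reasoning
  reversal : ∀ a b → not (not a ∨ b) ∨ a ≡ a
  reversal true  b = ∨-zeroʳ _
  reversal false b = refl
  same-outcome : ∀ X → nextWins⁻ (⁅∗⁆ ⊕ X) ≡ nextWins⁻ (𝟘 ⊕ X)
  same-outcome (mk zero    g) = refl
  same-outcome X@(mk (suc k) g) = begin
    not (nextWins⁻ (∗ ⊕ X)) ∨ anyFin (suc k) (λ j → not (nextWins⁻ (⁅∗⁆ ⊕ g j)))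
      ≡⟨ cong (not (nextWins⁻ (∗ ⊕ X)) ∨_) (anyFin-cong (λ j → cong not (same-outcome (g j)))) ⟩
    not (nextWins⁻ (∗ ⊕ X)) ∨ nextWins⁻ (𝟘 ⊕ X)
      ≡⟨ reversal (nextWins⁻ (𝟘 ⊕ X)) _ ⟩
    nextWins⁻ (𝟘 ⊕ X)
      ∎

options≈𝟘∗⇒≈𝟘∗∗2 : ∀ {n} {f : Fin n → Game} → (∀ i → f i ≈ 𝟘 ⊎ f i ≈ ∗) →
  mk n f ≈ 𝟘 ⊎ mk n f ≈ ∗ ⊎ mk n f ≈ ∗2
options≈𝟘∗⇒≈𝟘∗∗2 {n} {f} class with any? (λ i → ≈𝟘? (class i)) | any? (λ i → ≈∗? (class i))
... | no ∄𝟘 | no ∄∗ = inj₁ (options≈⇒≈ (mk n f) 𝟘 to𝟘 λ ())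
  where
  to𝟘 : f ≈⊆ options 𝟘
  to𝟘 i = ⊥-elim ([ (λ e → ∄𝟘 (i , e)) , (λ e → ∄∗ (i , e)) ] (class i))
... | yes (i , fi≈𝟘) | no ∄∗ = inj₂ (inj₁ (options≈⇒≈ (mk n f) ∗ to∗ λ _ → i , ≈-sym fi≈𝟘))
  where
  to∗ : f ≈⊆ options ∗
  to∗ j = zero , [ (λ e → e) , (λ e → ⊥-elim (∄∗ (j , e))) ] (class j)
... | no ∄𝟘 | yes (i , fi≈∗) = inj₁ (≈-trans (options≈⇒≈ (mk n f) ⁅∗⁆ to⁅∗⁆ λ _ → i , ≈-sym fi≈∗) ⁅∗⁆≈𝟘)
  where
  to⁅∗⁆ : f ≈⊆ options ⁅∗⁆
  to⁅∗⁆ j = zero , [ (λ e → ⊥-elim (∄𝟘 (j , e))) , (λ e → e) ] (class j)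
... | yes (i , fi≈𝟘) | yes (j , fj≈∗) = inj₂ (inj₂ (options≈⇒≈ (mk n f) ∗2 to∗2 from∗2))
  where
  to∗2 : f ≈⊆ options ∗2
  to∗2 i = [ (λ e → zero , e) , (λ e → suc zero , e) ] (class i)
  from∗2 : options ∗2 ≈⊆ f
  from∗2 zero       = i , ≈-sym fi≈𝟘
  from∗2 (suc zero) = j , ≈-sym fj≈∗

≈𝟘-or-≈∗-unless-∗2 : (𝒜 : Game → Set) → (∀ {n f} → 𝒜 (mk n f) → (i : Fin n) → 𝒜 (f i)) →
  (∀ G → 𝒜 G → ¬ G ≈ ∗2) → ∀ G → 𝒜 G → G ≈ 𝟘 ⊎ G ≈ ∗
≈𝟘-or-≈∗-unless-∗2 𝒜 option-closed no∗2 (mk n f) 𝒜G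
  with options≈𝟘∗⇒≈𝟘∗∗2 (λ i → ≈𝟘-or-≈∗-unless-∗2 𝒜 option-closed no∗2 (f i) (option-closed 𝒜G i))
... | inj₁ G≈𝟘         = inj₁ G≈𝟘
... | inj₂ (inj₁ G≈∗)  = inj₂ G≈∗
... | inj₂ (inj₂ G≈∗2) = ⊥-elim (no∗2 (mk n f) 𝒜G G≈∗2)

lemma4p8 : ExcludedMiddle 0ℓ → (𝒜 : Game → Set) → Closed 𝒜 → Σ Game 𝒜 →
    ((G : Game) → 𝒜 G → (G =⁻ 𝟘) ⊎ (G =⁻ ∗))
    ⊎ Σ Game (λ G → 𝒜 G × (G =⁻ ∗2))
lemma4p8 em 𝒜 closed _ with em {Σ Game (λ G → 𝒜 G × (G =⁻ ∗2))}
... | yes ∃∗2 = inj₂ ∃∗2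
... | no  ∄∗2 = inj₁ λ G 𝒜G →
  Sum.map ≈⇒=⁻ ≈⇒=⁻ (≈𝟘-or-≈∗-unless-∗2 𝒜 (Closed.option-closed closed) no∗2 G 𝒜G)
  where
  no∗2 : ∀ G → 𝒜 G → ¬ G ≈ ∗2
  no∗2 G 𝒜G G≈∗2 = ∄∗2 (G , 𝒜G , ≈⇒=⁻ G≈∗2)
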